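{- Let $k \ge 2$ and let $n \ge m \ge 1$ be integers. Then $d_k(K_{m,n}) = m + \left\lceil \frac{n}{2} \right\rceil - 1$.
   Context: $K_{m,n}$ is the complete bipartite graph with parts of sizes $m$ and $n$. The $k$-move deduction game ($k$ a positive integer) on a finite graph $G$: a layout places a finite number of searchers on vertices of $G$ (several searchers may share a vertex). Every searcher is initially mobile. A vertex is protected once it has been occupied by some searcher (so initially occupied vertices are protected); other vertices are unprotected. The game proceeds in stages. At each stage, for every vertex $v$ that has at least one unprotected neighbour: if the number of mobile searchers on $v$ is at least the number of unprotected neighbours of $v$, then the mobile searchers on $v$ move to the unprotected neighbours of $v$ so that each unprotected neighbour receives at least one searcher; excess mobile searchers on $v$ may also move to any of these unprotected neighbours. All moves in a stage happen simultaneously, newly occupied vertices become protected, and a searcher that has moved $k$ times becomes immobile. The process repeats until all vertices are protected or no searcher can move. A layout is successful if all vertices of $G$ end up protected. The $k$-move deduction number $d_k(G)$ is the minimum number of searchers in a successful layout on $G$. -}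

module Defs where

open import Data.Nat using (ℕ; zero; suc; _+_; _∸_; _<_; _≤_; _<ᵇ_; _≤ᵇ_)
open import Data.Bool using (Bool; true; false; not; _∧_; _∨_; _xor_; T)
open import Data.Fin using (Fin; toℕ; _≟_)
open import Data.List.Base using (List; length; filterᵇ; allFin)
open import Data.Product using (Σ; Σ-syntax; _×_; _,_)
open import Relation.Nullary using (¬_)
open import Relation.Nullary.Decidable using (⌊_⌋)
open import Relation.Binary.PropositionalEquality using (_≡_; refl)
open import Relation.Binary.Construct.Closure.ReflexiveTransitive using (Star)

record Graph : Set where
  field
    N      : ℕ
    adj    : Fin N → Fin N → Bool
    sym    : ∀ u v → adj u v ≡ adj v u
    irrefl : ∀ v → adj v v ≡ false
open Graph public

countB : ∀ {n} → (Fin n → Bool) → ℕ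
countB {n} p = length (filterᵇ p (allFin n))

record State (G : Graph) (S : ℕ) : Set where
  field
    pos   : Fin S → Fin (N G)
    moves : Fin S → ℕ
    prot  : Fin (N G) → Bool
open State public

module Game (G : Graph) (k : ℕ) (S : ℕ) where

  unprotNbr : State G S → Fin (N G) → Fin (N G) → Bool
  unprotNbr s v u = adj G v u ∧ not (prot s u)

  mobile : State G S → Fin S → Bool
  mobile s i = moves s i <ᵇ k

  mobileAt : State G S → Fin (N G) → Fin S → Bool
  mobileAt s v i = mobile s i ∧ ⌊ pos s i ≟ v ⌋

  nUnprot : State G S → Fin (N G) → ℕ
  nUnprot s v = countB (unprotNbr s v)

  nMobile : State G S → Fin (N G) → ℕ
  nMobile s v = countB (mobileAt s v)

  active : State G S → Fin (N G) → Bool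
  active s v = (0 <ᵇ nUnprot s v) ∧ (nUnprot s v ≤ᵇ nMobile s v)

  occupied : State G S → Fin (N G) → Bool
  occupied s u = 0 <ᵇ countB (λ i → ⌊ pos s i ≟ u ⌋)

  moving : State G S → Fin S → Bool
  moving s i = mobile s i ∧ active s (pos s i)

  -- One stage of the game (all firing vertices fire simultaneously;
  -- the choice of destinations is free subject to the rules).
  Step : State G S → State G S → Set
  Step s s' =
      (∀ i → (T (moving s i) →
                 T (unprotNbr s (pos s i) (pos s' i)) × moves s' i ≡ suc (moves s i))
           × (¬ T (moving s i) →
                 pos s' i ≡ pos s i × moves s' i ≡ moves s i))
    × (∀ v u → T (active s v) → T (unprotNbr s v u) →
         Σ[ i ∈ Fin S ] (pos s i ≡ v × T (mobile s i) × pos s' i ≡ u))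
    × (∀ u → prot s' u ≡ (prot s u ∨ occupied s' u))

  initial : (Fin S → Fin (N G)) → State G S
  initial p = record { pos = p ; moves = λ _ → 0 ; prot = occupied′ }
    where
      occupied′ : Fin (N G) → Bool
      occupied′ u = 0 <ᵇ countB (λ i → ⌊ p i ≟ u ⌋)

  Successful : (Fin S → Fin (N G)) → Set
  Successful p = Σ[ s ∈ State G S ] (Star Step (initial p) s × (∀ u → T (prot s u)))

IsDeductionNumber : ℕ → Graph → ℕ → Set
IsDeductionNumber k G d =
    (Σ[ p ∈ (Fin d → Fin (N G)) ] Game.Successful G k d p)
  × (∀ S → S < d → (p : Fin S → Fin (N G)) → ¬ Game.Successful G k S p)

-- complete bipartite graph K_{m,n}: vertices 0..m-1 form one part,
-- m..m+n-1 the other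
private
  xor-comm : ∀ a b → a xor b ≡ b xor a
  xor-comm false false = refl
  xor-comm false true  = refl
  xor-comm true  false = refl
  xor-comm true  true  = refl

  xor-self : ∀ a → a xor a ≡ false
  xor-self false = refl
  xor-self true  = refl

K : ℕ → ℕ → Graph
K m n = record
  { N      = m + n
  ; adj    = λ u v → (toℕ u <ᵇ m) xor (toℕ v <ᵇ m)
  ; sym    = λ u v → xor-comm (toℕ u <ᵇ m) (toℕ v <ᵇ m)
  ; irrefl = λ v → xor-self (toℕ v <ᵇ m)
  }

{-# OPTIONS --safe #-}
module Submission where

-- A vertex that fires holds at least as many searchers as it has
-- unprotected neighbours, that is unprotected vertices on the other side, and
-- every other protected vertex holds a searcher of its own.  If nothing fires
-- at the start, all m + n vertices were occupied; if vertices on both sides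
-- fire, m + n ≤ S + 2.  If only vertices of one side X fire, the first stage
-- occupies the whole other side and leaves X untouched, so the vertex that
-- fired gives |¬X| + |X protected| ≤ S + 1 and, unless X was protected from
-- the start, a vertex firing in the second stage gives
-- |¬X| + |X unprotected| ≤ S + 1.  With m ≤ n every case yields
-- 2m + n ≤ 2S + 2, that is S ≥ m + ⌈n/2⌉ - 1.
--
-- Occupy every vertex of the first part except a₀ = 0, and ⌈n/2⌉
-- vertices of the second part.  These have a₀ as their only unprotected
-- neighbour, so in the first stage all their searchers gather on a₀; in the
-- second stage a₀ holds ⌈n/2⌉ ≥ ⌊n/2⌋ mobile searchers (k ≥ 2) and protects
-- the rest.  Such a play exists because every state has a successor: an active
-- vertex can always send its mobile searchers onto its unprotected neighbours.

open import Defs hiding (sym)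
open import Data.Bool using (Bool; true; false; not; _∧_; _∨_; _xor_; T; if_then_else_)
open import Data.Bool.Properties
  using (T-∧; T-∨; T-≡; T-not-≡; T?; not-involutive; ∧-zeroʳ; ∧-identityʳ; ∧-comm;
         not-distribˡ-xor; not-distribʳ-xor)
open import Data.Empty using (⊥; ⊥-elim)
open import Data.Fin using (Fin; zero; suc; toℕ; _≟_; fromℕ<; inject≤)
open import Data.Fin.Properties using (toℕ<n; toℕ-fromℕ<; toℕ-inject≤; toℕ-injective; any?)
open import Data.List.Base using (length; filterᵇ; tabulate)
open import Data.Nat using (ℕ; zero; suc; _+_; _∸_; _≤_; _<_; _<ᵇ_; _≤ᵇ_; z≤n; s≤s; ⌈_/2⌉; ⌊_/2⌋)
open import Data.Nat.Properties hiding (_≟_)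
open import Data.Nat.Tactic.RingSolver using (solve-∀)
open import Data.Product using (Σ-syntax; ∃-syntax; _×_; _,_; proj₁; proj₂)
open import Data.Sum using (_⊎_; inj₁; inj₂)
open import Data.Vec.Functional using (_∷_)
open import Function using (_∘_; id; Equivalence; case_of_)
open import Relation.Binary.Construct.Closure.ReflexiveTransitive using (Star; ε; _◅_)
open import Relation.Binary.PropositionalEquality
open import Relation.Nullary using (¬_; yes; no; contradiction)
open import Relation.Nullary.Decidable
  using (⌊_⌋; _×-dec_; toWitness; fromWitness; toWitnessFalse; fromWitnessFalse)
open import Relation.Nullary.Negation using (¬∃⟶∀¬)

open Equivalence using (to; from)

if-T : ∀ {A : Set} {b} {x y : A} → T b → (if b then x else y) ≡ x
if-T {b = true} _ = refl

if-¬T : ∀ {A : Set} {b} {x y : A} → ¬ T b → (if b then x else y) ≡ y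
if-¬T {b = true}  ¬b = ⊥-elim (¬b _)
if-¬T {b = false} _  = refl

T-or-T-not : ∀ b → T b ⊎ T (not b)
T-or-T-not true  = inj₁ _
T-or-T-not false = inj₂ _

T-not⇒¬T : ∀ {b} → T (not b) → ¬ T b
T-not⇒¬T {false} _ ()

¬T⇒T-not : ∀ {b} → ¬ T b → T (not b)
¬T⇒T-not {true}  ¬b = ¬b _
¬T⇒T-not {false} _  = _

∨-absorbs : ∀ {x y} → (T y → T x) → x ∨ y ≡ x
∨-absorbs {true}          _   = refl
∨-absorbs {false} {false} _   = refl
∨-absorbs {false} {true}  y⇒x = ⊥-elim (y⇒x _)

xor-not-not : ∀ x y → x xor y ≡ not x xor not y
xor-not-not x y = begin
  x xor y               ≡⟨ not-involutive (x xor y) ⟨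
  not (not (x xor y))   ≡⟨ cong not (not-distribʳ-xor x y) ⟩
  not (x xor not y)     ≡⟨ not-distribˡ-xor x (not y) ⟩
  not x xor not y       ∎
  where open ≡-Reasoning

count : ∀ {n} → (Fin n → Bool) → ℕ
count {zero}  p = 0
count {suc n} p = if p zero then suc (count (p ∘ suc)) else count (p ∘ suc)

length-filterᵇ-tabulate : ∀ {A : Set} {n} (p : A → Bool) (f : Fin n → A) →
                          length (filterᵇ p (tabulate f)) ≡ count (p ∘ f)
length-filterᵇ-tabulate {n = zero}  p f = refl
length-filterᵇ-tabulate {n = suc n} p f with p (f zero)
... | true  = cong suc (length-filterᵇ-tabulate p (f ∘ suc))
... | false = length-filterᵇ-tabulate p (f ∘ suc)

countB≡count : ∀ {n} (p : Fin n → Bool) → countB p ≡ count p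
countB≡count p = length-filterᵇ-tabulate p id

count-cong : ∀ {n} {p q : Fin n → Bool} → p ≗ q → count p ≡ count q
count-cong {zero}          p≗q = refl
count-cong {suc n} {p} {q} p≗q rewrite p≗q zero =
  cong (λ c → if q zero then suc c else c) (count-cong (p≗q ∘ suc))

countB-cong : ∀ {n} {p q : Fin n → Bool} → p ≗ q → countB p ≡ countB q
countB-cong {p = p} {q} p≗q = trans (countB≡count p) (trans (count-cong p≗q) (sym (countB≡count q)))

count-mono : ∀ {n} {p q : Fin n → Bool} → (∀ i → T (p i) → T (q i)) → count p ≤ count q
count-mono {zero}          p⊆q = z≤n
count-mono {suc n} {p} {q} p⊆q with p zero in p₀ | q zero in q₀
... | true  | true  = s≤s (count-mono (p⊆q ∘ suc))
... | false | true  = m≤n⇒m≤1+n (count-mono (p⊆q ∘ suc))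
... | false | false = count-mono (p⊆q ∘ suc)
... | true  | false = ⊥-elim (subst T q₀ (p⊆q zero (subst T (sym p₀) _)))

count-empty : ∀ {n} {p : Fin n → Bool} → (∀ i → ¬ T (p i)) → count p ≡ 0
count-empty {zero}      _    = refl
count-empty {suc n} {p} none with p zero in p₀
... | true  = contradiction (subst T (sym p₀) _) (none zero)
... | false = count-empty (none ∘ suc)

count-pos : ∀ {n} {p : Fin n → Bool} i → T (p i) → 0 < count p
count-pos {p = p} zero    pi with p zero
... | true  = s≤s z≤n
count-pos {p = p} (suc i) pi with p zero
... | true  = s≤s z≤n
... | false = count-pos i pi

count-witness : ∀ {n} {p : Fin n → Bool} → 0 < count p → ∃[ i ] T (p i)
count-witness {suc n} {p} pos with p zero in p₀
... | true  = zero , subst T (sym p₀) _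
... | false = let i , pi = count-witness pos in suc i , pi

count-true : ∀ n → count {n} (λ _ → true) ≡ n
count-true zero    = refl
count-true (suc n) = cong suc (count-true n)

count-split : ∀ {n} (p q : Fin n → Bool) →
              count (λ i → p i ∧ q i) + count (λ i → p i ∧ not (q i)) ≡ count p
count-split {zero}  p q = refl
count-split {suc n} p q with p zero | q zero | count-split (p ∘ suc) (q ∘ suc)
... | true  | true  | ih = cong suc ih
... | true  | false | ih = trans (+-suc _ _) (cong suc ih)
... | false | _     | ih = ih

count-complement : ∀ {n} (p : Fin n → Bool) → count p + count (not ∘ p) ≡ n
count-complement {n} p = trans (count-split (λ _ → true) p) (count-true n)

count-single : ∀ {n} (j : Fin n) → count (λ i → ⌊ i ≟ j ⌋) ≡ 1
count-single {suc n} zero    = cong suc (count-empty {n} λ _ ())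
count-single {suc n} (suc j) = trans (count-cong suc≟suc) (count-single j)
  where
  suc≟suc : ∀ i → ⌊ suc i ≟ suc j ⌋ ≡ ⌊ i ≟ j ⌋
  suc≟suc i with i ≟ j
  ... | yes _ = refl
  ... | no  _ = refl

count-∨ : ∀ {n} {p q : Fin n → Bool} → (∀ i → T (p i) → ¬ T (q i)) →
          count (λ i → p i ∨ q i) ≡ count p + count q
count-∨ {zero}          _        = refl
count-∨ {suc n} {p} {q} disjoint
  with p zero in p₀ | q zero in q₀ | count-∨ {p = p ∘ suc} {q ∘ suc} (disjoint ∘ suc)
... | true  | true  | _  = contradiction (subst T (sym q₀) _) (disjoint zero (subst T (sym p₀) _))
... | true  | false | ih = cong suc ih
... | false | true  | ih = trans (cong suc ih) (sym (+-suc _ _))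
... | false | false | ih = ih

count-<ᵇ : ∀ {n c} → c ≤ n → count {n} (λ i → toℕ i <ᵇ c) ≡ c
count-<ᵇ {n}     {zero}  _         = count-empty {n} λ _ ()
count-<ᵇ {suc n} {suc c} (s≤s c≤n) = cong suc (count-<ᵇ c≤n)

remove : ∀ {n} → Fin n → (Fin n → Bool) → Fin n → Bool
remove j p i = p i ∧ not ⌊ i ≟ j ⌋

count≤suc-remove : ∀ {n} (p : Fin n → Bool) j → count p ≤ suc (count (remove j p))
count≤suc-remove p j = begin
  count p                                             ≡⟨ count-split p (λ i → ⌊ i ≟ j ⌋) ⟨
  count (λ i → p i ∧ ⌊ i ≟ j ⌋) + count (remove j p)  ≤⟨ +-monoˡ-≤ (count (remove j p)) at-most-j ⟩
  suc (count (remove j p))                            ∎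
  where
  open ≤-Reasoning
  at-most-j : count (λ i → p i ∧ ⌊ i ≟ j ⌋) ≤ 1
  at-most-j = ≤-trans (count-mono {q = λ i → ⌊ i ≟ j ⌋} (λ i → proj₂ ∘ T-∧ {p i} .to))
                      (≤-reflexive (count-single j))

count-remove : ∀ {n} {p : Fin n → Bool} j → T (p j) → count p ≡ suc (count (remove j p))
count-remove {p = p} j pj = begin
  count p                                             ≡⟨ count-split p (λ i → ⌊ i ≟ j ⌋) ⟨
  count (λ i → p i ∧ ⌊ i ≟ j ⌋) + count (remove j p)  ≡⟨ cong (_+ count (remove j p)) exactly-j ⟩
  suc (count (remove j p))                            ∎
  where
  open ≡-Reasoning
  at-j : ∀ i → (p i ∧ ⌊ i ≟ j ⌋) ≡ ⌊ i ≟ j ⌋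
  at-j i with i ≟ j
  ... | yes refl = trans (∧-identityʳ (p i)) (T-≡ .to pj)
  ... | no  _    = ∧-zeroʳ (p i)
  exactly-j : count (λ i → p i ∧ ⌊ i ≟ j ⌋) ≡ 1
  exactly-j = trans (count-cong at-j) (count-single j)

module _ {N S : ℕ} where

  Into : (Fin S → Fin N) → (Fin S → Bool) → (Fin N → Bool) → Set
  Into g Q P = ∀ i → T (Q i) → T (P (g i))

  Onto : (Fin S → Fin N) → (Fin S → Bool) → (Fin N → Bool) → Set
  Onto g Q P = ∀ v → T (P v) → ∃[ i ] T (Q i) × g i ≡ v

onto⇒count≤ : ∀ {N S} {P : Fin N → Bool} {Q : Fin S → Bool} (g : Fin S → Fin N) →
              Onto g Q P → count P ≤ count Q
onto⇒count≤ {S = zero}  g onto = ≤-reflexive (count-empty λ v Pv → case onto v Pv of λ ())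
onto⇒count≤ {S = suc S} {P} {Q} g onto with Q zero in Q₀
... | false = onto⇒count≤ (g ∘ suc) onto-tail
  where
  onto-tail : Onto (g ∘ suc) (Q ∘ suc) P
  onto-tail v Pv with onto v Pv
  ... | zero  , Q0 , _ = ⊥-elim (subst T Q₀ Q0)
  ... | suc i , Qi , e = i , Qi , e
... | true = ≤-trans (count≤suc-remove P (g zero)) (s≤s (onto⇒count≤ (g ∘ suc) onto-tail))
  where
  onto-tail : Onto (g ∘ suc) (Q ∘ suc) (remove (g zero) P)
  onto-tail v P′v with T-∧ {P v} .to P′v | onto v (proj₁ (T-∧ {P v} .to P′v))
  ... | _ , v≢g₀ | zero  , _ , refl = ⊥-elim (toWitnessFalse v≢g₀ refl)
  ... | _ , _    | suc i , Qi , e   = i , Qi , e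

-- Each vertex of P outside W is q i for an index i of its own, with q i outside W.
count-covered≤ : ∀ {N S} {P : Fin N → Bool} (q : Fin S → Fin N) → (∀ v → T (P v) → ∃[ i ] q i ≡ v) →
                 (W : Fin N → Bool) → count (W ∘ q) + count P ≤ S + count W
count-covered≤ {N} {S} {P} q covered W = begin
  count (W ∘ q) + count P
    ≡⟨ cong (count (W ∘ q) +_) (count-split P W) ⟨
  count (W ∘ q) + (count (λ v → P v ∧ W v) + count (λ v → P v ∧ not (W v)))
    ≤⟨ +-monoʳ-≤ (count (W ∘ q)) (+-mono-≤ (count-mono (λ v → proj₂ ∘ T-∧ {P v} .to)) outside) ⟩
  count (W ∘ q) + (count W + count (not ∘ W ∘ q))
    ≡⟨ reshuffle (count (W ∘ q)) (count W) (count (not ∘ W ∘ q)) ⟩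
  (count (W ∘ q) + count (not ∘ W ∘ q)) + count W
    ≡⟨ cong (_+ count W) (count-complement (W ∘ q)) ⟩
  S + count W ∎
  where
  open ≤-Reasoning
  reshuffle : ∀ a b c → a + (b + c) ≡ (a + c) + b
  reshuffle = solve-∀
  outside : count (λ v → P v ∧ not (W v)) ≤ count (not ∘ W ∘ q)
  outside = onto⇒count≤ q λ v P∖Wv →
    let Pv , ¬Wv = T-∧ {P v} .to P∖Wv
        i , qi≡v = covered v Pv
    in i , subst (T ∘ not ∘ W) (sym qi≡v) ¬Wv , qi≡v

count≤⇒onto : ∀ {N S} (P : Fin N → Bool) (Q : Fin S → Bool) → 0 < count P → count P ≤ count Q →
              Σ[ g ∈ (Fin S → Fin N) ] Into g Q P × Onto g Q P
count≤⇒onto {S = zero}  P Q 0<P P≤Q = contradiction (≤-trans 0<P P≤Q) λ ()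
-- P≤Q is abstracted again so that its type computes along the value of Q zero.
count≤⇒onto {S = suc S} P Q 0<P P≤Q with count-witness 0<P | Q zero in Q₀ | P≤Q
... | v₀ , Pv₀ | false | P≤Q =
  let g , into , onto = count≤⇒onto P (Q ∘ suc) 0<P P≤Q
  in (v₀ ∷ g) , (λ { zero _ → Pv₀ ; (suc i) → into i }) ,
     λ v Pv → let i , Qi , e = onto v Pv in suc i , Qi , e
... | v₀ , Pv₀ | true  | P≤Q = (v₀ ∷ g) , (λ { zero _ → Pv₀ ; (suc i) → into i }) , onto
  where
  rest : Σ[ g ∈ (Fin S → Fin _) ] Into g (Q ∘ suc) P × Onto g (Q ∘ suc) (remove v₀ P)
  rest with any? (λ v → T? (remove v₀ P v))
  ... | no  P′-empty = (λ _ → v₀) , (λ _ _ → Pv₀) , λ v P′v → contradiction (v , P′v) P′-empty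
  ... | yes (v₁ , P′v₁) =
    let P′<P            = ≤-reflexive (sym (count-remove v₀ Pv₀))
        g , into , onto = count≤⇒onto (remove v₀ P) (Q ∘ suc) (count-pos v₁ P′v₁) (≤-pred (≤-trans P′<P P≤Q))
    in g , (λ i → proj₁ ∘ T-∧ {P (g i)} .to ∘ into i) , onto

  g    = proj₁ rest
  into = proj₁ (proj₂ rest)

  onto : Onto (v₀ ∷ g) Q P
  onto v Pv with v ≟ v₀
  ... | yes refl = zero , subst T (sym Q₀) _ , refl
  ... | no  v≢v₀ =
    let i , Qi , e = proj₂ (proj₂ rest) v (T-∧ .from (Pv , fromWitnessFalse v≢v₀)) in suc i , Qi , e

module GameProperties (G : Graph) (k S : ℕ) where
  open Game G k S public

  private
    variable
      s s′ : State G S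
      u v  : Fin (N G)
      i    : Fin S

  searchersAt : State G S → Fin (N G) → Fin S → Bool
  searchersAt s v i = ⌊ pos s i ≟ v ⌋

  nUnprot≡count : ∀ s v → nUnprot s v ≡ count (unprotNbr s v)
  nUnprot≡count s v = countB≡count (unprotNbr s v)

  nMobile≡count : ∀ s v → nMobile s v ≡ count (mobileAt s v)
  nMobile≡count s v = countB≡count (mobileAt s v)

  occupied≡count : ∀ s u → occupied s u ≡ (0 <ᵇ count (searchersAt s u))
  occupied≡count s u = cong (0 <ᵇ_) (countB≡count (searchersAt s u))

  occupied⇒∃ : T (occupied s u) → ∃[ i ] pos s i ≡ u
  occupied⇒∃ {s} {u} occ =
    let i , at-u = count-witness (<ᵇ⇒< 0 _ (subst T (occupied≡count s u) occ)) in i , toWitness at-u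

  ∃⇒occupied : ∀ i → pos s i ≡ u → T (occupied s u)
  ∃⇒occupied {s} {u} i at-u = subst T (sym (occupied≡count s u)) (<⇒<ᵇ (count-pos i (fromWitness at-u)))

  active⇒0<nUnprot : T (active s v) → 0 < nUnprot s v
  active⇒0<nUnprot {s} {v} act = <ᵇ⇒< 0 _ (proj₁ (T-∧ {0 <ᵇ nUnprot s v} .to act))

  active⇒nUnprot≤nMobile : T (active s v) → nUnprot s v ≤ nMobile s v
  active⇒nUnprot≤nMobile {s} {v} act = ≤ᵇ⇒≤ _ _ (proj₂ (T-∧ {0 <ᵇ nUnprot s v} .to act))

  active-intro : 0 < nUnprot s v → nUnprot s v ≤ nMobile s v → T (active s v)
  active-intro 0<U U≤M = T-∧ .from (<⇒<ᵇ 0<U , ≤⇒≤ᵇ U≤M)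

  active⇒unprotNbr : T (active s v) → ∃[ u ] T (unprotNbr s v u)
  active⇒unprotNbr {s} {v} act = count-witness (subst (0 <_) (nUnprot≡count s v) (active⇒0<nUnprot act))

  active⇒1≤S : T (active s v) → 1 ≤ S
  active⇒1≤S {s} {v} act =
    let 0<M   = subst (0 <_) (nMobile≡count s v) (≤-trans (active⇒0<nUnprot act) (active⇒nUnprot≤nMobile act))
        i , _ = count-witness {p = mobileAt s v} 0<M
    in ≤-trans (s≤s z≤n) (toℕ<n i)

  nMobile≤searchersAt : ∀ s v → nMobile s v ≤ count (searchersAt s v)
  nMobile≤searchersAt s v =
    ≤-trans (≤-reflexive (nMobile≡count s v)) (count-mono λ i → proj₂ ∘ T-∧ {mobile s i} .to)

  active⇒nUnprot≤searchersAt : T (active s v) → nUnprot s v ≤ count (searchersAt s v)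
  active⇒nUnprot≤searchersAt {s} {v} act = ≤-trans (active⇒nUnprot≤nMobile act) (nMobile≤searchersAt s v)

  nUnprot+occupied≤S+1 : {P : Fin (N G) → Bool} → T (active s v) → (∀ u → T (P u) → ∃[ i ] pos s i ≡ u) →
                         nUnprot s v + count P ≤ S + 1
  nUnprot+occupied≤S+1 {s} {v} {P} act occupied = begin
    nUnprot s v + count P                ≤⟨ +-monoˡ-≤ (count P) (active⇒nUnprot≤searchersAt act) ⟩
    count (searchersAt s v) + count P    ≤⟨ count-covered≤ (pos s) occupied (λ u → ⌊ u ≟ v ⌋) ⟩
    S + count (λ u → ⌊ u ≟ v ⌋)          ≡⟨ cong (S +_) (count-single v) ⟩
    S + 1                                ∎
    where open ≤-Reasoning

  step-moves : Step s s′ → T (moving s i) → T (unprotNbr s (pos s i) (pos s′ i)) × moves s′ i ≡ suc (moves s i)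
  step-moves (moved , _ , _) = proj₁ (moved _)

  step-stays : Step s s′ → ¬ T (moving s i) → pos s′ i ≡ pos s i × moves s′ i ≡ moves s i
  step-stays (moved , _ , _) = proj₂ (moved _)

  step-reaches : Step s s′ → T (active s v) → T (unprotNbr s v u) → ∃[ i ] pos s′ i ≡ u
  step-reaches (_ , covered , _) act un = let i , _ , _ , at-u = covered _ _ act un in i , at-u

  step-keeps : Step s s′ → T (prot s u) → T (prot s′ u)
  step-keeps {u = u} (_ , _ , prot′) p = subst T (sym (prot′ u)) (T-∨ .from (inj₁ p))

  step-settles : Step s s′ → T (occupied s′ u) → T (prot s′ u)
  step-settles {u = u} (_ , _ , prot′) occ = subst T (sym (prot′ u)) (T-∨ .from (inj₂ occ))

  step-new : Step s s′ → T (prot s′ u) → T (prot s u) ⊎ T (occupied s′ u)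
  step-new {u = u} (_ , _ , prot′) p = T-∨ .to (subst T (prot′ u) p)

  step-protects : Step s s′ → T (active s v) → T (unprotNbr s v u) → T (prot s′ u)
  step-protects {s′ = s′} st act un =
    let i , at-u = step-reaches st act un in step-settles st (∃⇒occupied {s′} i at-u)

  Settled : State G S → Set
  Settled s = ∀ u → T (occupied s u) → T (prot s u)

  Inert : State G S → Set
  Inert s = (∀ v → ¬ T (active s v)) × Settled s

  inert-step : Inert s → Step s s′ → Inert s′ × (∀ u → prot s′ u ≡ prot s u)
  inert-step {s} {s′} (idle , settled) st = (idle′ , λ _ → step-settles st) , prot≡
    where
    still : ∀ i → pos s′ i ≡ pos s i × moves s′ i ≡ moves s i
    still i = step-stays st (idle (pos s i) ∘ proj₂ ∘ T-∧ {mobile s i} .to)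

    occupied≡ : ∀ u → occupied s′ u ≡ occupied s u
    occupied≡ u = cong (0 <ᵇ_) (countB-cong λ i → cong (λ w → ⌊ w ≟ u ⌋) (proj₁ (still i)))

    prot≡ : ∀ u → prot s′ u ≡ prot s u
    prot≡ u = begin
      prot s′ u                  ≡⟨ proj₂ (proj₂ st) u ⟩
      prot s u ∨ occupied s′ u   ≡⟨ cong (prot s u ∨_) (occupied≡ u) ⟩
      prot s u ∨ occupied s u    ≡⟨ ∨-absorbs (settled u) ⟩
      prot s u                   ∎
      where open ≡-Reasoning

    idle′ : ∀ v → ¬ T (active s′ v)
    idle′ v = idle v ∘ subst T (cong₂ (λ U M → (0 <ᵇ U) ∧ (U ≤ᵇ M)) unprot≡ mobile≡)
      where
      unprot≡ : nUnprot s′ v ≡ nUnprot s v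
      unprot≡ = countB-cong λ u → cong (λ b → adj G v u ∧ not b) (prot≡ u)
      mobile≡ : nMobile s′ v ≡ nMobile s v
      mobile≡ = countB-cong λ i → cong₂ (λ m w → (m <ᵇ k) ∧ ⌊ w ≟ v ⌋) (proj₂ (still i)) (proj₁ (still i))

  inert⇒already-protected : Inert s → Star Step s s′ → (∀ u → T (prot s′ u)) → ∀ u → T (prot s u)
  inert⇒already-protected inert ε            done u = done u
  inert⇒already-protected inert (st ◅ play) done u =
    let inert′ , prot≡ = inert-step inert st in subst T (prot≡ u) (inert⇒already-protected inert′ play done u)

  active-if-unfinished : Settled s → Star Step s s′ → (∀ u → T (prot s′ u)) → ¬ T (prot s u) →
                         ∃[ v ] T (active s v)
  active-if-unfinished {s} {u = u} settled play done ¬prot with any? (λ v → T? (active s v))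
  ... | yes found = found
  ... | no  none  = contradiction (inert⇒already-protected (¬∃⟶∀¬ none , settled) play done u) ¬prot

  no-active⇒N≤S : ∀ {p} → (∀ v → ¬ T (active (initial p) v)) → Successful p → N G ≤ S
  no-active⇒N≤S {p} idle (_ , play , done) = begin
    N G                        ≡⟨ count-true (N G) ⟨
    count {N G} (λ _ → true)   ≤⟨ count-mono (λ u _ → all-protected u) ⟩
    count (prot (initial p))   ≤⟨ onto⇒count≤ p by-layout ⟩
    count {S} (λ _ → true)     ≡⟨ count-true S ⟩
    S                          ∎
    where
    open ≤-Reasoning
    all-protected : ∀ u → T (prot (initial p) u)
    all-protected = inert⇒already-protected (idle , λ _ occ → occ) play done
    by-layout : Onto p (λ _ → true) (prot (initial p))
    by-layout u prot-u = let i , pi≡u = occupied⇒∃ {initial p} prot-u in i , _ , pi≡u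

  Assignment : State G S → Fin (N G) → (Fin S → Fin (N G)) → Set
  Assignment s v g = Into g (mobileAt s v) (unprotNbr s v) × Onto g (mobileAt s v) (unprotNbr s v)

  assignment : ∀ s v → Σ[ g ∈ (Fin S → Fin (N G)) ] (T (active s v) → Assignment s v g)
  assignment s v with T? (active s v)
  ... | yes act =
    let 0<U    = subst (0 <_) (nUnprot≡count s v) (active⇒0<nUnprot act)
        U≤M    = subst₂ _≤_ (nUnprot≡count s v) (nMobile≡count s v) (active⇒nUnprot≤nMobile act)
        g , a  = count≤⇒onto (unprotNbr s v) (mobileAt s v) 0<U U≤M
    in g , λ _ → a
  ... | no ¬act = (λ _ → v) , λ act → contradiction act ¬act

  successor : ∀ s → ∃[ s′ ] Step s s′
  successor s = next , (λ i → moved i , stayed i) , covered , λ _ → refl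
    where
    target : Fin S → Fin (N G)
    target i = proj₁ (assignment s (pos s i)) i

    pos′ : Fin S → Fin (N G)
    pos′ i = if moving s i then target i else pos s i

    next : State G S
    next = record
      { pos   = pos′
      ; moves = λ i → if moving s i then suc (moves s i) else moves s i
      ; prot  = λ u → prot s u ∨ (0 <ᵇ countB (λ i → ⌊ pos′ i ≟ u ⌋))
      }

    moved : ∀ i → T (moving s i) → T (unprotNbr s (pos s i) (pos′ i)) × moves next i ≡ suc (moves s i)
    moved i mv =
      let mob , act = T-∧ {mobile s i} .to mv
          into      = proj₁ (proj₂ (assignment s (pos s i)) act)
      in subst (T ∘ unprotNbr s (pos s i)) (sym (if-T mv)) (into i (T-∧ .from (mob , fromWitness refl))) , if-T mv

    stayed : ∀ i → ¬ T (moving s i) → pos′ i ≡ pos s i × moves next i ≡ moves s i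
    stayed i ¬mv = if-¬T ¬mv , if-¬T ¬mv

    covered : ∀ v u → T (active s v) → T (unprotNbr s v u) →
              Σ[ j ∈ Fin S ] (pos s j ≡ v × T (mobile s j) × pos′ j ≡ u)
    covered v u act un =
      let j , mob-at , gj≡u = proj₂ (proj₂ (assignment s v) act) u un
          mob , at          = T-∧ {mobile s j} .to mob-at
          at-v              = toWitness at
      in j , at-v , mob , (begin
        pos′ j                             ≡⟨ if-T (T-∧ .from (mob , subst (T ∘ active s) (sym at-v) act)) ⟩
        proj₁ (assignment s (pos s j)) j   ≡⟨ cong (λ w → proj₁ (assignment s w) j) at-v ⟩
        proj₁ (assignment s v) j           ≡⟨ gj≡u ⟩
        u                                  ∎)
      where open ≡-Reasoning

module CompleteBipartite (G : Graph) (X : Fin (N G) → Bool) (adj≡xor : ∀ u v → adj G u v ≡ X u xor X v) where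

  adj-inside : ∀ v u → T (X v) → adj G v u ≡ not (X u)
  adj-inside v u in-v = trans (adj≡xor v u) (cong (_xor X u) (T-≡ .to in-v))

  adj-outside : ∀ v u → T (not (X v)) → adj G v u ≡ X u
  adj-outside v u out-v = trans (adj≡xor v u) (cong (_xor X u) (T-not-≡ .to out-v))

module CompleteBipartiteGame (G : Graph) (X : Fin (N G) → Bool) (adj≡xor : ∀ u v → adj G u v ≡ X u xor X v)
                             (k S : ℕ) (p : Fin S → Fin (N G)) where
  open GameProperties G k S
  open CompleteBipartite G X adj≡xor

  private
    variable
      u v w : Fin (N G)
      i     : Fin S

  s₀ : State G S
  s₀ = initial p

  protectedIn unprotectedIn : (Fin (N G) → Bool) → State G S → ℕ
  protectedIn   Y s = count (λ u → Y u ∧ prot s u)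
  unprotectedIn Y s = count (λ u → Y u ∧ not (prot s u))

  protected+unprotected : ∀ Y s → protectedIn Y s + unprotectedIn Y s ≡ count Y
  protected+unprotected Y s = count-split Y (prot s)

  count-prot : ∀ s → count (prot s) ≡ protectedIn X s + protectedIn (not ∘ X) s
  count-prot s = trans (sym (count-split (prot s) X))
                       (cong₂ _+_ (count-cong λ u → ∧-comm (prot s u) _) (count-cong λ u → ∧-comm (prot s u) _))

  nUnprot-inside : ∀ s v → T (X v) → nUnprot s v ≡ unprotectedIn (not ∘ X) s
  nUnprot-inside s v in-v =
    trans (nUnprot≡count s v) (count-cong λ u → cong (_∧ not (prot s u)) (adj-inside v u in-v))

  nUnprot-outside : ∀ s v → T (not (X v)) → nUnprot s v ≡ unprotectedIn X s
  nUnprot-outside s v out-v =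
    trans (nUnprot≡count s v) (count-cong λ u → cong (_∧ not (prot s u)) (adj-outside v u out-v))

  initially-occupied : T (prot s₀ u) → ∃[ i ] p i ≡ u
  initially-occupied = occupied⇒∃ {s₀}

  both-sides-active⇒N≤S+2 : T (X v) → T (active s₀ v) → T (not (X w)) → T (active s₀ w) →
                            count X + count (not ∘ X) ≤ S + 2
  both-sides-active⇒N≤S+2 {v} {w} in-v act-v out-w act-w = begin
    count X + count (not ∘ X)
      ≡⟨ cong₂ _+_ (protected+unprotected X s₀) (protected+unprotected (not ∘ X) s₀) ⟨
    (protectedIn X s₀ + unprotectedIn X s₀) + (protectedIn (not ∘ X) s₀ + unprotectedIn (not ∘ X) s₀)
      ≡⟨ reshuffle (protectedIn X s₀) (unprotectedIn X s₀) (protectedIn (not ∘ X) s₀) (unprotectedIn (not ∘ X) s₀) ⟩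
    (unprotectedIn (not ∘ X) s₀ + unprotectedIn X s₀) + (protectedIn X s₀ + protectedIn (not ∘ X) s₀)
      ≡⟨ cong₂ _+_ (cong₂ _+_ (nUnprot-inside s₀ v in-v) (nUnprot-outside s₀ w out-w)) (count-prot s₀) ⟨
    (nUnprot s₀ v + nUnprot s₀ w) + count (prot s₀)
      ≤⟨ +-monoˡ-≤ (count (prot s₀)) (+-mono-≤ (active⇒nUnprot≤searchersAt act-v)
                                               (active⇒nUnprot≤searchersAt act-w)) ⟩
    (count (searchersAt s₀ v) + count (searchersAt s₀ w)) + count (prot s₀)
      ≡⟨ cong (_+ count (prot s₀)) (count-∨ {p = searchersAt s₀ v} {searchersAt s₀ w} (disjoint ∘ p)) ⟨
    count (W ∘ p) + count (prot s₀)
      ≤⟨ count-covered≤ p (λ _ → initially-occupied) W ⟩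
    S + count W
      ≡⟨ cong (S +_) (trans (count-∨ disjoint) (cong₂ _+_ (count-single v) (count-single w))) ⟩
    S + 2 ∎
    where
    open ≤-Reasoning
    reshuffle : ∀ a b c d → (a + b) + (c + d) ≡ (d + b) + (a + c)
    reshuffle = solve-∀
    W : Fin (N G) → Bool
    W u = ⌊ u ≟ v ⌋ ∨ ⌊ u ≟ w ⌋
    disjoint : ∀ u → T ⌊ u ≟ v ⌋ → ¬ T ⌊ u ≟ w ⌋
    disjoint u u≡v u≡w with trans (sym (toWitness u≡v)) (toWitness u≡w)
    ... | refl = T-not⇒¬T out-w in-v

  module OneSideActive {w s₁ s} (in-w : T (X w)) (act-w : T (active s₀ w))
                       (quiet : ∀ v → T (not (X v)) → ¬ T (active s₀ v))
                       (st : Step s₀ s₁) (play : Star Step s₁ s) (done : ∀ u → T (prot s u)) where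

    movers-inside : T (moving s₀ i) → T (X (p i))
    movers-inside {i} mv with T-or-T-not (X (p i))
    ... | inj₁ in-pi  = in-pi
    ... | inj₂ out-pi = ⊥-elim (quiet (p i) out-pi (proj₂ (T-∧ {mobile s₀ i} .to mv)))

    outside-occupied : T (not (X u)) → T (occupied s₁ u)
    outside-occupied {u} out-u with T-or-T-not (prot s₀ u)
    ... | inj₁ prot-u =
      let i , pi≡u = initially-occupied prot-u
          stays    = step-stays st (T-not⇒¬T (subst (T ∘ not ∘ X) (sym pi≡u) out-u) ∘ movers-inside)
      in ∃⇒occupied {s₁} i (trans (proj₁ stays) pi≡u)
    ... | inj₂ ¬prot-u =
      let i , at-u = step-reaches st act-w (T-∧ .from (subst T (sym (adj-inside w u in-w)) out-u , ¬prot-u))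
      in ∃⇒occupied {s₁} i at-u

    inside-unchanged : T (X u) → T (prot s₁ u) → T (prot s₀ u)
    inside-unchanged {u} in-u prot₁ with step-new st prot₁
    ... | inj₁ prot₀ = prot₀
    ... | inj₂ occ with occupied⇒∃ {s₁} occ
    ...   | i , at-u with T? (moving s₀ i)
    ...     | yes mv  = ⊥-elim (T-not⇒¬T (subst (T ∘ not ∘ X) at-u moved-out) in-u)
      where
      moved-out : T (not (X (pos s₁ i)))
      moved-out = subst T (adj-inside (p i) (pos s₁ i) (movers-inside mv))
                          (proj₁ (T-∧ .to (proj₁ (step-moves st mv))))
    ...     | no  ¬mv = ∃⇒occupied {s₀} i (trans (sym (proj₁ (step-stays st ¬mv))) at-u)

    bound-at-start : count (not ∘ X) + protectedIn X s₀ ≤ S + 1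
    bound-at-start = begin
      count (not ∘ X) + protectedIn X s₀
        ≡⟨ cong (_+ protectedIn X s₀) (protected+unprotected (not ∘ X) s₀) ⟨
      (protectedIn (not ∘ X) s₀ + unprotectedIn (not ∘ X) s₀) + protectedIn X s₀
        ≡⟨ reshuffle (protectedIn (not ∘ X) s₀) (unprotectedIn (not ∘ X) s₀) (protectedIn X s₀) ⟩
      unprotectedIn (not ∘ X) s₀ + (protectedIn X s₀ + protectedIn (not ∘ X) s₀)
        ≡⟨ cong₂ _+_ (nUnprot-inside s₀ w in-w) (count-prot s₀) ⟨
      nUnprot s₀ w + count (prot s₀)
        ≤⟨ nUnprot+occupied≤S+1 act-w (λ _ → initially-occupied) ⟩
      S + 1 ∎
      where
      open ≤-Reasoning
      reshuffle : ∀ a b c → (a + b) + c ≡ b + (c + a)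
      reshuffle = solve-∀

    -- If X is not yet protected, some vertex v₁ fires in the second stage.  Its
    -- unprotected neighbours lie in X, the rest being occupied after the first
    -- stage, so v₁ lies outside X.
    bound-after-first-stage : unprotectedIn X s₀ + count (not ∘ X) ≤ S + 1
    bound-after-first-stage with any? (λ u → T? (X u ∧ not (prot s₀ u)))
    ... | no none = begin
      unprotectedIn X s₀ + count (not ∘ X)   ≡⟨ cong (_+ count (not ∘ X)) (count-empty (¬∃⟶∀¬ none)) ⟩
      count (not ∘ X)                        ≤⟨ m≤m+n (count (not ∘ X)) (protectedIn X s₀) ⟩
      count (not ∘ X) + protectedIn X s₀     ≤⟨ bound-at-start ⟩
      S + 1                                  ∎
      where open ≤-Reasoning
    ... | yes (u , unprot-u) = begin
      unprotectedIn X s₀ + count (not ∘ X)   ≤⟨ +-monoˡ-≤ (count (not ∘ X)) still-unprotected ⟩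
      unprotectedIn X s₁ + count (not ∘ X)   ≡⟨ cong (_+ count (not ∘ X)) (nUnprot-outside s₁ v₁ out-v₁) ⟨
      nUnprot s₁ v₁ + count (not ∘ X)        ≤⟨ nUnprot+occupied≤S+1 act-v₁ (λ _ → occupied⇒∃ {s₁} ∘ outside-occupied) ⟩
      S + 1                                  ∎
      where
      open ≤-Reasoning
      still-unprotected : unprotectedIn X s₀ ≤ unprotectedIn X s₁
      still-unprotected = count-mono λ x unprot-x →
        let in-x , ¬prot-x = T-∧ {X x} .to unprot-x
        in T-∧ .from (in-x , ¬T⇒T-not (T-not⇒¬T ¬prot-x ∘ inside-unchanged in-x))

      in-u    = proj₁ (T-∧ {X u} .to unprot-u)
      ¬prot-u = proj₂ (T-∧ {X u} .to unprot-u)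
      active₁ = active-if-unfinished (λ _ → step-settles st) play done (T-not⇒¬T ¬prot-u ∘ inside-unchanged in-u)
      v₁      = proj₁ active₁
      act-v₁  = proj₂ active₁

      out-v₁ : T (not (X v₁))
      out-v₁ with T-or-T-not (X v₁)
      ... | inj₂ out = out
      ... | inj₁ in-v₁ =
        let x , un             = active⇒unprotNbr act-v₁
            adj-v₁x , ¬prot-x  = T-∧ {adj G v₁ x} .to un
            out-x              = subst T (adj-inside v₁ x in-v₁) adj-v₁x
        in ⊥-elim (T-not⇒¬T ¬prot-x (step-settles st (outside-occupied out-x)))

    bound : count (not ∘ X) + count (not ∘ X) + count X ≤ S + S + 2
    bound = begin
      count (not ∘ X) + count (not ∘ X) + count X
        ≡⟨ cong (count (not ∘ X) + count (not ∘ X) +_) (protected+unprotected X s₀) ⟨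
      count (not ∘ X) + count (not ∘ X) + (protectedIn X s₀ + unprotectedIn X s₀)
        ≡⟨ reshuffle (count (not ∘ X)) (protectedIn X s₀) (unprotectedIn X s₀) ⟩
      (count (not ∘ X) + protectedIn X s₀) + (unprotectedIn X s₀ + count (not ∘ X))
        ≤⟨ +-mono-≤ bound-at-start bound-after-first-stage ⟩
      (S + 1) + (S + 1)
        ≡⟨ twice-suc S ⟩
      S + S + 2 ∎
      where
      open ≤-Reasoning
      reshuffle : ∀ a b c → a + a + (b + c) ≡ (a + b) + (c + a)
      reshuffle = solve-∀
      twice-suc : ∀ a → (a + 1) + (a + 1) ≡ a + a + 2
      twice-suc = solve-∀

  one-side-active⇒bound : T (X w) → T (active s₀ w) → (∀ v → T (not (X v)) → ¬ T (active s₀ v)) →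
                          Successful p → count (not ∘ X) + count (not ∘ X) + count X ≤ S + S + 2
  one-side-active⇒bound {w} _ act-w _ (_ , ε , done) =
    let u , un = active⇒unprotNbr act-w in ⊥-elim (T-not⇒¬T (proj₂ (T-∧ {adj G w u} .to un)) (done u))
  one-side-active⇒bound in-w act-w quiet (_ , st ◅ play , done) =
    OneSideActive.bound in-w act-w quiet st play done

module Sides (m n : ℕ) where

  side : Fin (m + n) → Bool
  side v = toℕ v <ᵇ m

  count-side : count side ≡ m
  count-side = count-<ᵇ (m≤m+n m n)

  count-not-side : count (not ∘ side) ≡ n
  count-not-side =
    +-cancelˡ-≡ m _ _ (trans (cong (_+ count (not ∘ side)) (sym count-side)) (count-complement side))

m+n≤S+2⇒m+m+n≤S+S+2 : ∀ {m n S} → m ≤ n → m + n ≤ S + 2 → 1 ≤ S → m + m + n ≤ S + S + 2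
m+n≤S+2⇒m+m+n≤S+S+2 {m} {n} {S} m≤n m+n≤S+2 1≤S = begin
  m + m + n      ≡⟨ +-assoc m m n ⟩
  m + (m + n)    ≤⟨ +-mono-≤ m≤S m+n≤S+2 ⟩
  S + (S + 2)    ≡⟨ +-assoc S S 2 ⟨
  S + S + 2      ∎
  where
  open ≤-Reasoning
  reshuffle : ∀ a → a + 2 + a ≡ suc a + suc a
  reshuffle = solve-∀
  m≤S : m ≤ S
  m≤S = ≮⇒≥ λ S<m → <⇒≱ (subst (S + 2 <_) (reshuffle S) (m<m+n (S + 2) 1≤S))
                         (≤-trans (+-mono-≤ S<m (≤-trans S<m m≤n)) m+n≤S+2)

module LowerBound (m n k S : ℕ) (p : Fin S → Fin (m + n)) where
  open GameProperties (K m n) k S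
  open Sides m n
  private
    module A = CompleteBipartiteGame (K m n) side (λ _ _ → refl) k S p
    module B = CompleteBipartiteGame (K m n) (not ∘ side) (λ u v → xor-not-not (side u) (side v)) k S p

  s₀ : State (K m n) S
  s₀ = initial p

  lower-bound : m ≤ n → Successful p → m + m + n ≤ S + S + 2
  lower-bound m≤n success
    with any? (λ v → T? (side v) ×-dec T? (active s₀ v)) | any? (λ v → T? (not (side v)) ×-dec T? (active s₀ v))
  ... | no noA | no noB = begin
    m + m + n     ≡⟨ +-assoc m m n ⟩
    m + (m + n)   ≤⟨ +-mono-≤ (≤-trans (m≤m+n m n) m+n≤S) m+n≤S ⟩
    S + S         ≤⟨ m≤m+n (S + S) 2 ⟩
    S + S + 2     ∎
    where
    open ≤-Reasoning
    idle : ∀ v → ¬ T (active s₀ v)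
    idle v act with T-or-T-not (side v)
    ... | inj₁ in-v  = noA (v , in-v , act)
    ... | inj₂ out-v = noB (v , out-v , act)
    m+n≤S : m + n ≤ S
    m+n≤S = no-active⇒N≤S idle success
  ... | yes (a , in-a , act-a) | yes (c , out-c , act-c) =
    m+n≤S+2⇒m+m+n≤S+S+2 m≤n
      (subst₂ (λ x y → x + y ≤ S + 2) count-side count-not-side (A.both-sides-active⇒N≤S+2 in-a act-a out-c act-c))
      (active⇒1≤S act-a)
  ... | yes (a , in-a , act-a) | no noB = begin
    m + m + n     ≡⟨ reshuffle m m n ⟩
    m + n + m     ≤⟨ +-monoˡ-≤ m (+-monoˡ-≤ n m≤n) ⟩
    n + n + m     ≡⟨ cong₂ (λ x y → x + x + y) count-not-side count-side ⟨
    count (not ∘ side) + count (not ∘ side) + count side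
                  ≤⟨ A.one-side-active⇒bound in-a act-a (λ v out-v act → noB (v , out-v , act)) success ⟩
    S + S + 2     ∎
    where
    open ≤-Reasoning
    reshuffle : ∀ a b c → a + b + c ≡ a + c + b
    reshuffle = solve-∀
  ... | no noA | yes (c , out-c , act-c) = begin
    m + m + n     ≡⟨ cong₂ (λ x y → x + x + y) count-not-not-side count-not-side ⟨
    count (not ∘ not ∘ side) + count (not ∘ not ∘ side) + count (not ∘ side)
                  ≤⟨ B.one-side-active⇒bound out-c act-c (λ v in-v act → noA (v , inside v in-v , act)) success ⟩
    S + S + 2     ∎
    where
    open ≤-Reasoning
    count-not-not-side : count (not ∘ not ∘ side) ≡ m
    count-not-not-side = trans (count-cong (not-involutive ∘ side)) count-side
    inside : ∀ v → T (not (not (side v))) → T (side v)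
    inside v = subst T (not-involutive (side v))

module UpperBound (k m′ n t : ℕ) (2≤k : 2 ≤ k) (1≤t : 1 ≤ t) (t≤n : t ≤ n) (n≤t+t : n ≤ t + t) where
  open GameProperties (K (suc m′) n) k (m′ + t)
  open Sides (suc m′) n
  open CompleteBipartite (K (suc m′) n) side (λ _ _ → refl)

  private
    variable
      u : Fin (suc m′ + n)
      i : Fin (m′ + t)

  -- Searcher i starts on vertex i + 1: all of the first part but a₀ = 0 is
  -- occupied, and so are the vertices m′ + 1, …, m′ + t of the second part (by
  -- the searchers with onB i); the remaining free ones, at most t, are not.
  layout : Fin (m′ + t) → Fin (suc m′ + n)
  layout i = suc (inject≤ i (+-monoʳ-≤ m′ t≤n))

  a₀ : Fin (suc m′ + n)
  a₀ = zero

  s₀ : State (K (suc m′) n) (m′ + t)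
  s₀ = initial layout

  onB : Fin (m′ + t) → Bool
  onB i = not (toℕ i <ᵇ m′)

  count-onB : count onB ≡ t
  count-onB = +-cancelˡ-≡ m′ _ _ (trans (cong (_+ count onB) (sym (count-<ᵇ (m≤m+n m′ t)))) (count-complement _))

  onB⇒outside : ∀ i → T (onB i) → T (not (side (layout i)))
  onB⇒outside i = subst (λ x → T (not (x <ᵇ m′))) (sym (toℕ-inject≤ i _))

  free : Fin (suc m′ + n) → Bool
  free u = not (toℕ u <ᵇ suc (m′ + t))

  free⇒outside : ∀ u → T (free u) → T (not (side u))
  free⇒outside u free-u = ¬T⇒T-not λ in-u →
    T-not⇒¬T free-u (<⇒<ᵇ (≤-trans (<ᵇ⇒< (toℕ u) (suc m′) in-u) (s≤s (m≤m+n m′ t))))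

  count-free≤t : count free ≤ t
  count-free≤t = +-cancelˡ-≤ (suc (m′ + t)) _ _ (begin
    suc (m′ + t) + count free
      ≡⟨ cong (_+ count free) (count-<ᵇ {suc m′ + n} {suc (m′ + t)} (s≤s (+-monoʳ-≤ m′ t≤n))) ⟨
    count {suc m′ + n} (λ u → toℕ u <ᵇ suc (m′ + t)) + count free
      ≡⟨ count-complement {suc m′ + n} (λ u → toℕ u <ᵇ suc (m′ + t)) ⟩
    suc (m′ + n)
      ≤⟨ s≤s (+-monoʳ-≤ m′ n≤t+t) ⟩
    suc (m′ + (t + t))
      ≡⟨ cong suc (+-assoc m′ t t) ⟨
    suc (m′ + t) + t ∎)
    where open ≤-Reasoning

  a₀-unprotected : ¬ T (prot s₀ a₀)
  a₀-unprotected prot-a₀ with occupied⇒∃ {s₀} {a₀} prot-a₀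
  ... | _ , ()

  initially-unprotected : ¬ T (prot s₀ u) → u ≡ a₀ ⊎ T (free u)
  initially-unprotected {zero}   _ = inj₁ refl
  initially-unprotected {suc u′} ¬prot with toℕ u′ <? m′ + t
  ... | no  u′≮m′+t = inj₂ (¬T⇒T-not (u′≮m′+t ∘ <ᵇ⇒< _ _))
  ... | yes u′<m′+t = ⊥-elim (¬prot (∃⇒occupied {s₀} (fromℕ< u′<m′+t) (toℕ-injective (cong suc (begin
    toℕ (inject≤ (fromℕ< u′<m′+t) _)   ≡⟨ toℕ-inject≤ _ _ ⟩
    toℕ (fromℕ< u′<m′+t)               ≡⟨ toℕ-fromℕ< u′<m′+t ⟩
    toℕ u′                             ∎)))))
    where open ≡-Reasoning

  unprotNbr₀-outside≡a₀ : ∀ v u → T (not (side v)) → T (unprotNbr s₀ v u) → u ≡ a₀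
  unprotNbr₀-outside≡a₀ v u out-v un with T-∧ {adj (K (suc m′) n) v u} .to un
  ... | adj-vu , ¬prot-u with initially-unprotected (T-not⇒¬T ¬prot-u)
  ...   | inj₁ u≡a₀  = u≡a₀
  ...   | inj₂ free-u = ⊥-elim (T-not⇒¬T (free⇒outside u free-u) (subst T (adj-outside v u out-v) adj-vu))

  onB-active₀ : T (onB i) → T (active s₀ (layout i))
  onB-active₀ {i} onB-i = active-intro
    (subst (0 <_) (sym (nUnprot≡count s₀ b)) (count-pos {p = unprotNbr s₀ b} a₀ a₀-unprotNbr))
    (begin
      nUnprot s₀ b                           ≡⟨ nUnprot≡count s₀ b ⟩
      count (unprotNbr s₀ b)                 ≤⟨ count-mono {q = λ u → ⌊ u ≟ a₀ ⌋} only-a₀ ⟩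
      count {suc m′ + n} (λ u → ⌊ u ≟ a₀ ⌋)  ≡⟨ count-single a₀ ⟩
      1                                      ≤⟨ count-pos {p = mobileAt s₀ b} i i-mobile ⟩
      count (mobileAt s₀ b)                  ≡⟨ nMobile≡count s₀ b ⟨
      nMobile s₀ b                           ∎)
    where
    open ≤-Reasoning
    b     = layout i
    out-b = onB⇒outside i onB-i
    only-a₀ : ∀ u → T (unprotNbr s₀ b u) → T ⌊ u ≟ a₀ ⌋
    only-a₀ u = fromWitness ∘ unprotNbr₀-outside≡a₀ b u out-b
    i-mobile : T (mobileAt s₀ b i)
    i-mobile = T-∧ .from (<⇒<ᵇ (≤-trans (s≤s z≤n) 2≤k) , fromWitness refl)
    a₀-unprotNbr : T (unprotNbr s₀ b a₀)
    a₀-unprotNbr = T-∧ .from (subst T (sym (adj-outside b a₀ out-b)) _ , ¬T⇒T-not a₀-unprotected)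

  module AfterFirstStage {s₁} (st₁ : Step s₀ s₁) where

    gathered : T (onB i) → pos s₁ i ≡ a₀ × moves s₁ i ≡ 1
    gathered {i} onB-i =
      let un , moved = step-moves st₁ mv
      in unprotNbr₀-outside≡a₀ (layout i) (pos s₁ i) (onB⇒outside i onB-i) un , moved
      where
      mv : T (moving s₀ i)
      mv = T-∧ .from (<⇒<ᵇ (≤-trans (s≤s z≤n) 2≤k) , onB-active₀ onB-i)

    a₀-protected : T (prot s₁ a₀)
    a₀-protected =
      let i , onB-i = count-witness (subst (0 <_) (sym count-onB) 1≤t)
      in step-settles st₁ (∃⇒occupied {s₁} i (proj₁ (gathered onB-i)))

    unprotected⇒free : ∀ u → ¬ T (prot s₁ u) → T (free u)
    unprotected⇒free u ¬prot with initially-unprotected (¬prot ∘ step-keeps st₁)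
    ... | inj₁ refl   = ⊥-elim (¬prot a₀-protected)
    ... | inj₂ free-u = free-u

    unprotNbr-a₀ : ∀ u → ¬ T (prot s₁ u) → T (unprotNbr s₁ a₀ u)
    unprotNbr-a₀ u ¬prot =
      T-∧ .from (subst T (sym (adj-inside a₀ u _)) (free⇒outside u (unprotected⇒free u ¬prot)) , ¬T⇒T-not ¬prot)

    a₀-active : ¬ T (prot s₁ u) → T (active s₁ a₀)
    a₀-active {u} ¬prot = active-intro
      (subst (0 <_) (sym (nUnprot≡count s₁ a₀)) (count-pos {p = unprotNbr s₁ a₀} u (unprotNbr-a₀ u ¬prot)))
      (begin
        nUnprot s₁ a₀                ≡⟨ nUnprot≡count s₁ a₀ ⟩
        count (unprotNbr s₁ a₀)      ≤⟨ count-mono {q = free} unprotNbr⇒free ⟩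
        count free                   ≤⟨ count-free≤t ⟩
        t                            ≡⟨ count-onB ⟨
        count onB                    ≤⟨ count-mono gathered-mobile ⟩
        count (mobileAt s₁ a₀)       ≡⟨ nMobile≡count s₁ a₀ ⟨
        nMobile s₁ a₀                ∎)
      where
      open ≤-Reasoning
      unprotNbr⇒free : ∀ x → T (unprotNbr s₁ a₀ x) → T (free x)
      unprotNbr⇒free x = unprotected⇒free x ∘ T-not⇒¬T ∘ proj₂ ∘ T-∧ {adj (K (suc m′) n) a₀ x} .to
      gathered-mobile : ∀ i → T (onB i) → T (mobileAt s₁ a₀ i)
      gathered-mobile i onB-i =
        let at-a₀ , moved-once = gathered onB-i
        in T-∧ .from (subst (λ c → T (c <ᵇ k)) (sym moved-once) (<⇒<ᵇ 2≤k) , fromWitness at-a₀)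

    finished : ∀ {s₂} → Step s₁ s₂ → ∀ u → T (prot s₂ u)
    finished st₂ u with T-or-T-not (prot s₁ u)
    ... | inj₁ prot-u  = step-keeps st₂ prot-u
    ... | inj₂ ¬prot-u = step-protects {v = a₀} st₂ (a₀-active (T-not⇒¬T ¬prot-u))
                                                    (unprotNbr-a₀ u (T-not⇒¬T ¬prot-u))

  layout-successful : Successful layout
  layout-successful =
    let s₁ , st₁ = successor s₀
        s₂ , st₂ = successor s₁
    in s₂ , st₁ ◅ st₂ ◅ ε , AfterFirstStage.finished st₁ st₂

n≤⌈n/2⌉+⌈n/2⌉ : ∀ n → n ≤ ⌈ n /2⌉ + ⌈ n /2⌉
n≤⌈n/2⌉+⌈n/2⌉ n = begin
  n                    ≡⟨ ⌊n/2⌋+⌈n/2⌉≡n n ⟨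
  ⌊ n /2⌋ + ⌈ n /2⌉    ≤⟨ +-monoˡ-≤ ⌈ n /2⌉ (⌊n/2⌋≤⌈n/2⌉ n) ⟩
  ⌈ n /2⌉ + ⌈ n /2⌉    ∎
  where open ≤-Reasoning

⌈n/2⌉+⌈n/2⌉≤1+n : ∀ n → ⌈ n /2⌉ + ⌈ n /2⌉ ≤ suc n
⌈n/2⌉+⌈n/2⌉≤1+n zero          = z≤n
⌈n/2⌉+⌈n/2⌉≤1+n (suc zero)    = ≤-refl
⌈n/2⌉+⌈n/2⌉≤1+n (suc (suc n)) =
  subst (_≤ 3 + n) (cong suc (sym (+-suc ⌈ n /2⌉ ⌈ n /2⌉))) (s≤s (s≤s (⌈n/2⌉+⌈n/2⌉≤1+n n)))

too-few-searchers : ∀ {m′ n t S} → suc m′ + suc m′ + n ≤ S + S + 2 → S < m′ + t → t + t ≤ suc n → ⊥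
too-few-searchers {m′} {n} {t} {S} bound S<m′+t t+t≤1+n = <-irrefl refl (begin-strict
  suc m′ + suc m′ + n       ≤⟨ bound ⟩
  S + S + 2                 ≡⟨ reshuffle₁ S ⟩
  suc S + suc S             ≤⟨ +-mono-≤ S<m′+t S<m′+t ⟩
  (m′ + t) + (m′ + t)       ≡⟨ reshuffle₂ m′ t ⟩
  m′ + m′ + (t + t)         ≤⟨ +-monoʳ-≤ (m′ + m′) t+t≤1+n ⟩
  m′ + m′ + suc n           <⟨ n<1+n _ ⟩
  suc (m′ + m′ + suc n)     ≡⟨ reshuffle₃ m′ n ⟩
  suc m′ + suc m′ + n       ∎)
  where
  open ≤-Reasoning
  reshuffle₁ : ∀ a → a + a + 2 ≡ suc a + suc a
  reshuffle₁ = solve-∀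
  reshuffle₂ : ∀ a b → (a + b) + (a + b) ≡ a + a + (b + b)
  reshuffle₂ = solve-∀
  reshuffle₃ : ∀ a b → suc (a + a + suc b) ≡ suc a + suc a + b
  reshuffle₃ = solve-∀

theorem3p5 : (k m n : ℕ) → 2 ≤ k → 1 ≤ m → m ≤ n →
    IsDeductionNumber k (K m n) ((m + ⌈ n /2⌉) ∸ 1)
theorem3p5 k (suc m′) n 2≤k _ m≤n = (layout , layout-successful) , lower
  where
  open UpperBound k m′ n ⌈ n /2⌉ 2≤k (⌈n/2⌉-mono (≤-trans (s≤s z≤n) m≤n)) (⌈n/2⌉≤n n) (n≤⌈n/2⌉+⌈n/2⌉ n)

  lower : ∀ S → S < m′ + ⌈ n /2⌉ → (p : Fin S → Fin (suc m′ + n)) → ¬ Game.Successful (K (suc m′) n) k S p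
  lower S S<d p success =
    too-few-searchers (LowerBound.lower-bound (suc m′) n k S p m≤n success) S<d (⌈n/2⌉+⌈n/2⌉≤1+n n)
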